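{- Let $k\ge1$ and let $F_n^K(\mathbf z;q)=\sum_{\pi\in RLP_n^K}\big(\prod_j z_{\ell_j}\big)q^{\mathrm{inv}(\pi)}$ as in the context. Then for all $m,n\ge1$, $$F_{m+n}^k(\mathbf z;q)=F_m^k(\mathbf z;q)F_n^k(\mathbf z;q)+\sum_{i=2}^k\sum_{j=1}^{i-1}z_i\,q^{\binom{i}{2}}F_{m-j}^k(\mathbf z;q)F_{n-i+j}^k(\mathbf z;q);$$ for all $n\ge1$, $$F_n^k(\mathbf z;q)=F_n^{k-1}(\mathbf z;q)+\sum_{j=0}^{n-k}z_k\,q^{\binom{k}{2}}F_j^{k-1}(\mathbf z;q)F_{n-k-j}^k(\mathbf z;q);$$ and for all $n\ge1$, the $k\times k$ matrix $M$ with entries $M_{s,t}=F^k_{n+k-1+t-s}(\mathbf z;q)$ ($1\le s,t\le k$) satisfies $$\det M=\begin{cases}z_k^{n+k-1}q^{(n+k-1)\binom{k}{2}}&\text{if }k\text{ is odd},\\ (-1)^{n-1}z_k^{n+k-1}q^{(n+k-1)\binom{k}{2}}&\text{if }k\text{ is even}.\end{cases}$$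
   Context: For a composition $(\ell_1,\dots,\ell_r)$ of $n$, the associated reverse layered permutation of $[n]$ is the word whose first $\ell_1$ entries are $1,\dots,\ell_1$ in decreasing order, next $\ell_2$ entries are $\ell_1+1,\dots,\ell_1+\ell_2$ in decreasing order, and so on; these blocks are its layers, of lengths $\ell_j$. For $K\ge0$, $RLP_n^K$ is the set of reverse layered permutations of $[n]$ with all layers of length at most $K$. $\mathbf z=(z_1,\dots,z_k)$ are indeterminates, $\mathrm{inv}(\pi)$ is the number of inversions. Conventions: $F_0^K=1$ (empty permutation), $F_n^K=0$ for $n<0$. Thus the first row of $M$ is $F^k_{n+k-1},\dots,F^k_{n+2k-2}$ and the last row is $F^k_n,\dots,F^k_{n+k-1}$. -}

module Defs where

open import Level using (Level)
open import Data.Nat as ℕ using (ℕ; zero; suc; _∸_; _<ᵇ_; _≤ᵇ_)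
open import Data.Integer as ℤ using (ℤ; +_; -[1+_])
open import Data.Bool using (Bool; true; false)
open import Data.List using (List; []; _∷_; _++_; map; concatMap; filterᵇ; applyUpTo; reverse; length)
open import Data.Fin using (Fin; zero; suc; punchIn)
open import Algebra.Bundles using (CommutativeRing)

-- Compositions of n with all parts in {1,…,K}, as lists of part lengths.
-- The first argument is fuel (n suffices, since every part is ≥ 1).
compsFuel : ℕ → ℕ → ℕ → List (List ℕ)
compsFuel _        K zero    = [] ∷ []
compsFuel zero     K (suc n) = []
compsFuel (suc f)  K n       =
  concatMap (λ ℓ → map (ℓ ∷_) (compsFuel f K (n ∸ ℓ)))
            (filterᵇ (λ ℓ → ℓ ≤ᵇ K) (applyUpTo suc n))

compositions : ℕ → ℕ → List (List ℕ)
compositions K n = compsFuel n K n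

-- reverse layered permutation of a composition, with values shifted by 'off':
-- layer ℓ contributes off+ℓ, …, off+1 (decreasing)
rlpFrom : ℕ → List ℕ → List ℕ
rlpFrom off []       = []
rlpFrom off (ℓ ∷ ls) = reverse (applyUpTo (λ i → off ℕ.+ suc i) ℓ) ++ rlpFrom (off ℕ.+ ℓ) ls

rlp : List ℕ → List ℕ
rlp = rlpFrom 0

inv : List ℕ → ℕ
inv []       = 0
inv (x ∷ xs) = length (filterᵇ (λ y → y <ᵇ x) xs) ℕ.+ inv xs

-- number of summation terms for a ≤ i ≤ b (zero if b < a)
clip : ℤ → ℕ
clip (+ n)    = n
clip -[1+ n ] = 0

module Poly {c ℓ : Level} (R : CommutativeRing c ℓ) where
  open CommutativeRing R hiding (zero)

  pow : Carrier → ℕ → Carrier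
  pow x zero    = 1#
  pow x (suc n) = x * pow x n

  sumL : List Carrier → Carrier
  sumL []       = 0#
  sumL (x ∷ xs) = x + sumL xs

  sumN : ℕ → (ℕ → Carrier) → Carrier
  sumN zero    f = 0#
  sumN (suc n) f = f 0 + sumN n (λ i → f (suc i))

  sumFromTo : ℤ → ℤ → (ℤ → Carrier) → Carrier
  sumFromTo a b f = sumN (clip ((b ℤ.- a) ℤ.+ ℤ.+ 1)) (λ i → f (a ℤ.+ ℤ.+ i))

  sumFin : ∀ n → (Fin n → Carrier) → Carrier
  sumFin zero    f = 0#
  sumFin (suc n) f = f zero + sumFin n (λ j → f (suc j))

  zProd : (ℕ → Carrier) → List ℕ → Carrier
  zProd z []       = 1#
  zProd z (ℓ ∷ ls) = z ℓ * zProd z ls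

  F : (ℕ → Carrier) → Carrier → ℕ → ℕ → Carrier
  F z q K n = sumL (map (λ ls → zProd z ls * pow q (inv (rlp ls))) (compositions K n))

  FZ : (ℕ → Carrier) → Carrier → ℕ → ℤ → Carrier
  FZ z q K (+ n)    = F z q K n
  FZ z q K -[1+ n ] = 0#

  det : ∀ n → (Fin n → Fin n → Carrier) → Carrier
  det zero    M = 1#
  det (suc n) M = sumFin (suc n) (λ j →
    sgn j * (M zero j * det n (λ s t → M (suc s) (punchIn j t))))
    where
    sgn : ∀ {m} → Fin m → Carrier
    sgn zero    = 1#
    sgn (suc j) = - (sgn j)

module Submission where

-- The inversions of a reverse layered permutation are exactly the pairs inside its layers, so
-- F_n^K is the sum over compositions of n (parts ≤ K) of Πⱼ c_{ℓⱼ}, with cᵢ = zᵢ q^{i C 2}.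
-- Splitting off the first layer shows that F^K solves f(n) = Σ_{i=1}^{K} cᵢ f(n − i) + [n = 0],
-- and a solution of such a recurrence is determined by its inhomogeneous term (solves-unique).
-- Both convolution identities follow by checking that their right-hand sides solve the same
-- recurrence as the left-hand sides (modules SplitAt and RaiseOrder).  For the determinant, the
-- recurrence writes the first row of the Toeplitz matrix (f(p+1+t−s)) as a combination of the
-- rows of (f(p+t−s)); multilinearity and alternation give det_{p+1} = (−1)^{k−1} c_k det_p, and
-- det_0 = 1 by triangularity (module ToeplitzDeterminant).

open import Defs
open import Level using (Level)
open import Data.Nat using (ℕ; _≤_; _∸_)
open import Data.Nat.Combinatorics using (_C_)
open import Data.Integer using (ℤ; +_; ∣_∣) renaming (_+_ to _+ℤ_; _-_ to _-ℤ_)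
open import Data.Fin as Fin using (Fin; toℕ; punchIn)
open import Data.Fin.Properties using (toℕ<n)
open import Data.Product using (_×_; _,_)
open import Data.Nat.DivMod using (_%_; _/_; m≡m%n+[m/n]*n)
open import Relation.Binary.PropositionalEquality using (_≡_)
open import Algebra.Bundles using (CommutativeRing)

open import Data.Nat as ℕ using (zero; suc; _<_; _<ᵇ_; z≤n; s≤s)
import Data.Nat.Properties as ℕP
open import Data.Nat.Combinatorics using (nC1≡n; nCk+nC[k+1]≡[n+1]C[k+1])
open import Data.List using (List; []; _∷_; _++_; length; filterᵇ; applyUpTo; applyDownFrom; reverse; map)
open import Data.Nat.ListAction using (sum)
open import Data.List.Properties
  using (filter-++; filter-all; filter-none; length-++; length-applyDownFrom; reverse-applyUpTo)
open import Data.List.Relation.Unary.All as All using (All; []; _∷_)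
open import Data.List.Relation.Unary.All.Properties using (++⁺; applyDownFrom⁺₁; applyDownFrom⁺₂)
open import Data.Bool.Properties using (T?)
import Relation.Binary.PropositionalEquality as ≡
open import Data.Maybe using (nothing)
open import Tactic.RingSolver using (solve-∀)
open import Tactic.RingSolver.Core.AlmostCommutativeRing using (AlmostCommutativeRing; fromCommutativeRing)

-- Inversions of reverse layered permutations (pure arithmetic on words).
module LayerInversions where

  open ≡ using (refl; cong; cong₂)

  below : ℕ → List ℕ → ℕ
  below x ys = length (filterᵇ (λ y → y <ᵇ x) ys)

  below-++ : ∀ x xs ys → below x (xs ++ ys) ≡ below x xs ℕ.+ below x ys
  below-++ x xs ys =
    ≡.trans (cong length (filter-++ (λ y → T? (y <ᵇ x)) xs ys)) (length-++ (filterᵇ (λ y → y <ᵇ x) xs))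

  below-none : ∀ x ys → All (x ≤_) ys → below x ys ≡ 0
  below-none x ys x≤ys =
    cong length (filter-none (λ y → T? (y <ᵇ x)) (All.map (λ x≤y y<x → ℕP.<⇒≱ (ℕP.<ᵇ⇒< _ x y<x) x≤y) x≤ys))

  below-all : ∀ x ys → All (_< x) ys → below x ys ≡ length ys
  below-all x ys ys<x = cong length (filter-all (λ y → T? (y <ᵇ x)) (All.map ℕP.<⇒<ᵇ ys<x))

  inv-++ : ∀ xs ys → All (λ x → All (x ≤_) ys) xs → inv (xs ++ ys) ≡ inv xs ℕ.+ inv ys
  inv-++ []       ys []         = refl
  inv-++ (x ∷ xs) ys (x≤ys ∷ h) = begin
      below x (xs ++ ys) ℕ.+ inv (xs ++ ys)
    ≡⟨ cong₂ ℕ._+_ (below-++ x xs ys) (inv-++ xs ys h) ⟩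
      (below x xs ℕ.+ below x ys) ℕ.+ (inv xs ℕ.+ inv ys)
    ≡⟨ cong (λ b → (below x xs ℕ.+ b) ℕ.+ (inv xs ℕ.+ inv ys)) (below-none x ys x≤ys) ⟩
      (below x xs ℕ.+ 0) ℕ.+ (inv xs ℕ.+ inv ys)
    ≡⟨ cong (ℕ._+ (inv xs ℕ.+ inv ys)) (ℕP.+-identityʳ (below x xs)) ⟩
      below x xs ℕ.+ (inv xs ℕ.+ inv ys)
    ≡⟨ ℕP.+-assoc (below x xs) (inv xs) (inv ys) ⟨
      below x xs ℕ.+ inv xs ℕ.+ inv ys
    ∎
    where open ≡.≡-Reasoning

  inv-decreasing : ∀ (f : ℕ → ℕ) → (∀ {i j} → i < j → f i < f j) →
                   ∀ ℓ → inv (applyDownFrom f ℓ) ≡ ℓ C 2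
  inv-decreasing f f-mono zero    = refl
  inv-decreasing f f-mono (suc ℓ) = begin
      below (f ℓ) (applyDownFrom f ℓ) ℕ.+ inv (applyDownFrom f ℓ)
    ≡⟨ cong₂ ℕ._+_ (below-all (f ℓ) _ (applyDownFrom⁺₁ f ℓ f-mono)) (inv-decreasing f f-mono ℓ) ⟩
      length (applyDownFrom f ℓ) ℕ.+ ℓ C 2
    ≡⟨ cong (ℕ._+ ℓ C 2) (length-applyDownFrom f ℓ) ⟩
      ℓ ℕ.+ ℓ C 2
    ≡⟨ cong (ℕ._+ ℓ C 2) (nC1≡n ℓ) ⟨
      ℓ C 1 ℕ.+ ℓ C 2
    ≡⟨ nCk+nC[k+1]≡[n+1]C[k+1] ℓ 1 ⟩
      suc ℓ C 2
    ∎
    where open ≡.≡-Reasoning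

  layerPairs : List ℕ → ℕ
  layerPairs ls = sum (map (_C 2) ls)

  layer-decreasing : ∀ off ℓ →
    reverse (applyUpTo (λ i → off ℕ.+ suc i) ℓ) ≡ applyDownFrom (λ i → off ℕ.+ suc i) ℓ
  layer-decreasing off ℓ = reverse-applyUpTo (λ i → off ℕ.+ suc i) ℓ

  rlpFrom-above : ∀ off ls → All (off <_) (rlpFrom off ls)
  rlpFrom-above off []       = []
  rlpFrom-above off (ℓ ∷ ls) rewrite layer-decreasing off ℓ =
    ++⁺ (applyDownFrom⁺₂ (λ i → off ℕ.+ suc i) ℓ (λ i → ℕP.m<m+n off (s≤s z≤n)))
        (All.map (ℕP.≤-<-trans (ℕP.m≤m+n off ℓ)) (rlpFrom-above (off ℕ.+ ℓ) ls))

  inv-rlpFrom : ∀ off ls → inv (rlpFrom off ls) ≡ layerPairs ls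
  inv-rlpFrom off []       = refl
  inv-rlpFrom off (ℓ ∷ ls) rewrite layer-decreasing off ℓ =
    ≡.trans (inv-++ (applyDownFrom layerValue ℓ) (rlpFrom (off ℕ.+ ℓ) ls) layer-below-rest)
            (cong₂ ℕ._+_ (inv-decreasing layerValue (λ i<j → ℕP.+-monoʳ-< off (s≤s i<j)) ℓ)
                         (inv-rlpFrom (off ℕ.+ ℓ) ls))
    where
    layerValue : ℕ → ℕ
    layerValue i = off ℕ.+ suc i
    layer-below-rest : All (λ x → All (x ≤_) (rlpFrom (off ℕ.+ ℓ) ls)) (applyDownFrom layerValue ℓ)
    layer-below-rest = applyDownFrom⁺₁ layerValue ℓ (λ i<ℓ →
      All.map (λ top<y → ℕP.<⇒≤ (ℕP.≤-<-trans (ℕP.+-monoʳ-≤ off i<ℓ) top<y)) (rlpFrom-above (off ℕ.+ ℓ) ls))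

open LayerInversions using (layerPairs; inv-rlpFrom)

module IndexBookkeeping where

  open ≡ using (refl; cong)
  open import Data.Bool using (true; false)
  open import Data.Fin using (zero; suc)

  -- skip j t is the index, among all columns, of column t of the minor without column j.
  skip : ℕ → ℕ → ℕ
  skip zero    t       = suc t
  skip (suc j) zero    = zero
  skip (suc j) (suc t) = suc (skip j t)

  skip-below : ∀ a b → b < a → skip a b ≡ b
  skip-below (suc a) zero    _         = refl
  skip-below (suc a) (suc b) (s≤s b<a) = cong suc (skip-below a b b<a)

  skip-above : ∀ a b → a ≤ b → skip a b ≡ suc b
  skip-above zero    b       _         = refl
  skip-above (suc a) (suc b) (s≤s a≤b) = cong suc (skip-above a b a≤b)

  skip-skip : ∀ a b t → a ≤ b → skip a (skip b t) ≡ skip (suc b) (skip a t)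
  skip-skip zero    b       t       _         = refl
  skip-skip (suc a) (suc b) zero    _         = refl
  skip-skip (suc a) (suc b) (suc t) (s≤s a≤b) = cong suc (skip-skip a b t a≤b)

  toℕ-punchIn : ∀ {n} (j : Fin (suc n)) (t : Fin n) → toℕ (punchIn j t) ≡ skip (toℕ j) (toℕ t)
  toℕ-punchIn zero    t       = refl
  toℕ-punchIn (suc j) zero    = refl
  toℕ-punchIn (suc j) (suc t) = cong suc (toℕ-punchIn j t)

  <ᵇ-true : ∀ {m n} → m < n → (m <ᵇ n) ≡ true
  <ᵇ-true {zero}  {suc n} _         = refl
  <ᵇ-true {suc m} {suc n} (s≤s m<n) = <ᵇ-true m<n

  <ᵇ-false : ∀ {m n} → n ≤ m → (m <ᵇ n) ≡ false
  <ᵇ-false {m}     {zero}  _         = refl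
  <ᵇ-false {suc m} {suc n} (s≤s n≤m) = <ᵇ-false n≤m

open IndexBookkeeping

module IntegerRanges where

  open ≡ using (refl)
  open import Data.Integer using (_⊖_)
  import Data.Integer.Properties as ℤP

  clip-⊖ : ∀ a b → clip ((a ⊖ b) +ℤ + 1) ≡ suc a ∸ b
  clip-⊖ a       zero          = ℕP.+-comm a 1
  clip-⊖ zero    (suc zero)    = refl
  clip-⊖ zero    (suc (suc b)) = refl
  clip-⊖ (suc a) (suc b) rewrite ℤP.[1+m]⊖[1+n]≡m⊖n a b = clip-⊖ a b

  ⊖-minus : ∀ n b j → (n ⊖ b) -ℤ + j ≡ n ⊖ (b ℕ.+ j)
  ⊖-minus n b zero    = ≡.trans (ℤP.+-identityʳ (n ⊖ b)) (≡.cong (n ⊖_) (≡.sym (ℕP.+-identityʳ b)))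
  ⊖-minus n b (suc j) = ≡.trans (ℤP.distribˡ-⊖-+-neg j n b) (≡.cong (n ⊖_) (≡.sym (ℕP.+-suc b j)))

open IntegerRanges

module RingIdentities {c ℓ : Level} (R : CommutativeRing c ℓ) where

  private
    almostRing : AlmostCommutativeRing c ℓ
    almostRing = fromCommutativeRing R (λ _ → nothing)

  open AlmostCommutativeRing almostRing

  distrib-scaled : ∀ (c a d b : Carrier) → c * (a + d * b) ≈ c * a + d * (c * b)
  distrib-scaled = solve-∀ almostRing

  regroup-raise : ∀ (P D c Y G : Carrier) → (P + D) + c * (Y + G) ≈ ((P + c * G) + c * Y) + D
  regroup-raise = solve-∀ almostRing

  regroup-split : ∀ (X D F Y E : Carrier) → (X + D) * F + (Y + E) ≈ (X * F + Y) + (D * F + E)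
  regroup-split = solve-∀ almostRing

  distrib-weighted : ∀ (c y d G : Carrier) → (c * (y + d)) * G ≈ (c * y) * G + (c * d) * G
  distrib-weighted = solve-∀ almostRing

module _ {c ℓ : Level} (R : CommutativeRing c ℓ) where

  open CommutativeRing R hiding (zero)
  open ≡ using (_≡_; cong; cong₂) renaming (refl to ≡-refl)
  open Poly R
  open RingIdentities R
  open import Relation.Binary.Reasoning.Setoid setoid
  open import Data.Bool using (Bool; true; false; if_then_else_)
  open import Data.List using (concatMap)
  open import Data.List.Properties using (map-∘)
  open import Data.Nat using (_≤ᵇ_)
  open import Algebra.Properties.CommutativeSemigroup *-commutativeSemigroup using (interchange; x∙yz≈y∙xz)
  open import Algebra.Properties.CommutativeSemigroup +-commutativeSemigroup
    using () renaming (interchange to +-interchange)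
  open import Algebra.Solver.CommutativeMonoid *-commutativeMonoid using (solve; _⊕_; _⊜_)
  open import Relation.Nullary using (yes; no)
  open import Algebra.Properties.CommutativeSemiring.Exp commutativeSemiring
    using (_^_; ^-homo-*; ^-congˡ; ^-distrib-*; ^-assocʳ)
  open import Data.Integer using (_⊖_)
  import Data.Integer.Properties as ℤP
  open import Algebra.Properties.Ring ring
    using (-0#≈0#; -‿involutive; +-inverseʳ-unique; -‿+-comm; -‿distribˡ-*; -‿distribʳ-*; -1*x≈-x)

  -- Finite sums ∑ n f = Σ_{i<n} f i.  The sum is kept opaque so that Agda infers summands by
  -- unification instead of unfolding it; the lemmas below are its whole interface.
  opaque
    ∑ : ℕ → (ℕ → Carrier) → Carrier
    ∑ = sumN

  opaque
    unfolding ∑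

    ∑≡sumN : ∀ n f → ∑ n f ≡ sumN n f
    ∑≡sumN n f = ≡-refl

    ∑-0 : ∀ {f : ℕ → Carrier} → ∑ 0 f ≈ 0#
    ∑-0 = refl

    ∑-suc : ∀ n {f : ℕ → Carrier} → ∑ (suc n) f ≈ f 0 + ∑ n (λ i → f (suc i))
    ∑-suc n = refl

    ∑-cong< : ∀ n {f g : ℕ → Carrier} → (∀ i → i < n → f i ≈ g i) → ∑ n f ≈ ∑ n g
    ∑-cong< zero    h = refl
    ∑-cong< (suc n) h = +-cong (h 0 (s≤s z≤n)) (∑-cong< n (λ i i<n → h (suc i) (s≤s i<n)))

    ∑-zero : ∀ n {f : ℕ → Carrier} → (∀ i → f i ≈ 0#) → ∑ n f ≈ 0#
    ∑-zero zero    h = refl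
    ∑-zero (suc n) h = trans (+-cong (h 0) (∑-zero n (λ i → h (suc i)))) (+-identityˡ 0#)

    ∑-+ : ∀ n {f g : ℕ → Carrier} → ∑ n (λ i → f i + g i) ≈ ∑ n f + ∑ n g
    ∑-+ zero            = sym (+-identityˡ 0#)
    ∑-+ (suc n) {f} {g} = trans (+-congˡ (∑-+ n)) (+-interchange (f 0) (g 0) _ _)

    ∑-*ˡ : ∀ n (a : Carrier) {f : ℕ → Carrier} → a * ∑ n f ≈ ∑ n (λ i → a * f i)
    ∑-*ˡ zero    a     = zeroʳ a
    ∑-*ˡ (suc n) a {f} = trans (distribˡ a (f 0) _) (+-congˡ (∑-*ˡ n a))

    ∑-swap : ∀ n m {f : ℕ → ℕ → Carrier} → ∑ n (λ i → ∑ m (λ j → f i j)) ≈ ∑ m (λ j → ∑ n (λ i → f i j))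
    ∑-swap zero    m = sym (∑-zero m (λ j → refl))
    ∑-swap (suc n) m = trans (+-congˡ (∑-swap n m)) (sym (∑-+ m))

    ∑-neg : ∀ n {f : ℕ → Carrier} → ∑ n (λ i → - f i) ≈ - ∑ n f
    ∑-neg zero    = sym -0#≈0#
    ∑-neg (suc n) = trans (+-congˡ (∑-neg n)) (-‿+-comm _ _)

    ∑-split : ∀ a b {f : ℕ → Carrier} → ∑ (a ℕ.+ b) f ≈ ∑ a f + ∑ b (λ i → f (a ℕ.+ i))
    ∑-split zero    b     = sym (+-identityˡ _)
    ∑-split (suc a) b {f} = trans (+-congˡ (∑-split a b)) (sym (+-assoc (f 0) _ _))

  ∑-cong : ∀ n {f g : ℕ → Carrier} → (∀ i → f i ≈ g i) → ∑ n f ≈ ∑ n g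
  ∑-cong n h = ∑-cong< n (λ i _ → h i)

  ∑-*ʳ : ∀ n (a : Carrier) {f : ℕ → Carrier} → ∑ n f * a ≈ ∑ n (λ i → f i * a)
  ∑-*ʳ n a {f} = trans (*-comm _ a) (trans (∑-*ˡ n a) (∑-cong n (λ i → *-comm a (f i))))

  ∑-last : ∀ n {f : ℕ → Carrier} → ∑ (suc n) f ≈ ∑ n f + f n
  ∑-last n {f} = begin
      ∑ (suc n) f
    ≡⟨ cong (λ m → ∑ m f) (ℕP.+-comm 1 n) ⟩
      ∑ (n ℕ.+ 1) f
    ≈⟨ ∑-split n 1 ⟩
      ∑ n f + ∑ 1 (λ i → f (n ℕ.+ i))
    ≈⟨ +-congˡ (trans (∑-suc 0) (trans (+-congˡ ∑-0) (+-identityʳ _))) ⟩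
      ∑ n f + f (n ℕ.+ 0)
    ≡⟨ cong (λ i → ∑ n f + f i) (ℕP.+-identityʳ n) ⟩
      ∑ n f + f n
    ∎

  ∑-truncate : ∀ a b {f : ℕ → Carrier} → (∀ i → f (a ℕ.+ i) ≈ 0#) → ∑ (a ℕ.+ b) f ≈ ∑ a f
  ∑-truncate a b h = trans (∑-split a b) (trans (+-congˡ (∑-zero b h)) (+-identityʳ _))

  *-zeroʳ-by : ∀ {x y} → y ≈ 0# → x * y ≈ 0#
  *-zeroʳ-by y≈0 = trans (*-congˡ y≈0) (zeroʳ _)

  *-zeroˡ-by : ∀ {x y} → x ≈ 0# → x * y ≈ 0#
  *-zeroˡ-by x≈0 = trans (*-congʳ x≈0) (zeroˡ _)

  sumL-map-cong : ∀ {A : Set} {w w′ : A → Carrier} → (∀ x → w x ≈ w′ x) →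
                  ∀ xs → sumL (map w xs) ≈ sumL (map w′ xs)
  sumL-map-cong h []       = refl
  sumL-map-cong h (x ∷ xs) = +-cong (h x) (sumL-map-cong h xs)

  sumL-++ : ∀ {A : Set} (w : A → Carrier) xs ys → sumL (map w (xs ++ ys)) ≈ sumL (map w xs) + sumL (map w ys)
  sumL-++ w []       ys = sym (+-identityˡ _)
  sumL-++ w (x ∷ xs) ys = trans (+-congˡ (sumL-++ w xs ys)) (sym (+-assoc _ _ _))

  sumL-concatMap : ∀ {A B : Set} (w : B → Carrier) (h : A → List B) xs →
                   sumL (map w (concatMap h xs)) ≈ sumL (map (λ x → sumL (map w (h x))) xs)
  sumL-concatMap w h []       = refl
  sumL-concatMap w h (x ∷ xs) = trans (sumL-++ w (h x) (concatMap h xs)) (+-congˡ (sumL-concatMap w h xs))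

  sumL-filter : ∀ {A : Set} (w : A → Carrier) (p : A → Bool) xs →
                sumL (map w (filterᵇ p xs)) ≈ sumL (map (λ x → if p x then w x else 0#) xs)
  sumL-filter w p []       = refl
  sumL-filter w p (x ∷ xs) with p x
  ... | true  = +-congˡ (sumL-filter w p xs)
  ... | false = trans (sumL-filter w p xs) (sym (+-identityˡ _))

  sumL-applyUpTo : ∀ (w : ℕ → Carrier) (f : ℕ → ℕ) n →
                   sumL (map w (applyUpTo f n)) ≈ ∑ n (λ i → w (f i))
  sumL-applyUpTo w f zero    = sym (∑-0)
  sumL-applyUpTo w f (suc n) = trans (+-congˡ (sumL-applyUpTo w (λ i → f (suc i)) n)) (sym (∑-suc n))

  sumL-*ˡ : ∀ {A : Set} (a : Carrier) (w : A → Carrier) xs →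
            sumL (map (λ x → a * w x) xs) ≈ a * sumL (map w xs)
  sumL-*ˡ a w []       = sym (zeroʳ a)
  sumL-*ˡ a w (x ∷ xs) = trans (+-congˡ (sumL-*ˡ a w xs)) (sym (distribˡ a _ _))

  pow≡^ : ∀ x n → pow x n ≡ x ^ n
  pow≡^ x zero    = ≡-refl
  pow≡^ x (suc n) = cong (x *_) (pow≡^ x n)

  pow-+ : ∀ x m n → pow x (m ℕ.+ n) ≈ pow x m * pow x n
  pow-+ x m n rewrite pow≡^ x (m ℕ.+ n) | pow≡^ x m | pow≡^ x n = ^-homo-* x m n

  pow-cong : ∀ n {x y} → x ≈ y → pow x n ≈ pow y n
  pow-cong n {x} {y} x≈y rewrite pow≡^ x n | pow≡^ y n = ^-congˡ n x≈y

  pow-* : ∀ x y n → pow (x * y) n ≈ pow x n * pow y n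
  pow-* x y n rewrite pow≡^ (x * y) n | pow≡^ x n | pow≡^ y n = ^-distrib-* x y n

  pow-pow : ∀ x a n → pow (pow x a) n ≈ pow x (n ℕ.* a)
  pow-pow x a n rewrite pow≡^ (pow x a) n | pow≡^ x a | pow≡^ x (n ℕ.* a) =
    trans (^-assocʳ x a n) (reflexive (cong (x ^_) (ℕP.*-comm a n)))


  -- Delayed sequences and linear recurrences.

  -- lag φ a b is φ (a − b), read as 0 when b > a.
  lag : (ℕ → Carrier) → ℕ → ℕ → Carrier
  lag φ a       zero    = φ a
  lag φ zero    (suc b) = 0#
  lag φ (suc a) (suc b) = lag φ a b

  δ₀ : ℕ → Carrier
  δ₀ zero    = 1#
  δ₀ (suc _) = 0#

  recStep : (ℕ → Carrier) → ℕ → (ℕ → Carrier) → ℕ → Carrier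
  recStep c K φ a = ∑ K (λ i → c (suc i) * lag φ a (suc i))

  record Solves (c : ℕ → Carrier) (K : ℕ) (φ h : ℕ → Carrier) : Set ℓ where
    constructor solves
    field equation : ∀ a → φ a ≈ recStep c K φ a + h a

  open Solves

  lag-beyond : ∀ φ a b → a < b → lag φ a b ≡ 0#
  lag-beyond φ zero    (suc b) _         = ≡-refl
  lag-beyond φ (suc a) (suc b) (s≤s a<b) = lag-beyond φ a b a<b

  lag-within : ∀ φ a b → b ≤ a → lag φ a b ≡ φ (a ∸ b)
  lag-within φ a       zero    _         = ≡-refl
  lag-within φ (suc a) (suc b) (s≤s b≤a) = lag-within φ a b b≤a

  lag-lag : ∀ φ e a d → lag (λ y → lag φ y e) a d ≡ lag φ a (d ℕ.+ e)
  lag-lag φ e a       zero    = ≡-refl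
  lag-lag φ e zero    (suc d) = ≡-refl
  lag-lag φ e (suc a) (suc d) = lag-lag φ e a d

  lag-+ : ∀ φ ψ a d → lag (λ y → φ y + ψ y) a d ≈ lag φ a d + lag ψ a d
  lag-+ φ ψ a       zero    = refl
  lag-+ φ ψ zero    (suc d) = sym (+-identityˡ 0#)
  lag-+ φ ψ (suc a) (suc d) = lag-+ φ ψ a d

  lag-*ˡ : ∀ x φ a d → lag (λ y → x * φ y) a d ≈ x * lag φ a d
  lag-*ˡ x φ a       zero    = refl
  lag-*ˡ x φ zero    (suc d) = sym (zeroʳ x)
  lag-*ˡ x φ (suc a) (suc d) = lag-*ˡ x φ a d

  lag-*ʳ : ∀ x φ a d → lag (λ y → φ y * x) a d ≈ lag φ a d * x
  lag-*ʳ x φ a       zero    = refl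
  lag-*ʳ x φ zero    (suc d) = sym (zeroˡ x)
  lag-*ʳ x φ (suc a) (suc d) = lag-*ʳ x φ a d

  lag-∑ : ∀ n (Φ : ℕ → ℕ → Carrier) a d →
          lag (λ y → ∑ n (λ i → Φ i y)) a d ≈ ∑ n (λ i → lag (Φ i) a d)
  lag-∑ n Φ a       zero    = refl
  lag-∑ n Φ zero    (suc d) = sym (∑-zero n (λ i → refl))
  lag-∑ n Φ (suc a) (suc d) = lag-∑ n Φ a d

  lag-peel : ∀ φ a e → lag φ (suc a) e ≈ φ 0 * lag δ₀ (suc a) e + lag (λ j → φ (suc j)) a e
  lag-peel φ a       zero          = sym (trans (+-congʳ (zeroʳ (φ 0))) (+-identityˡ _))
  lag-peel φ zero    (suc zero)    = sym (trans (+-identityʳ _) (*-identityʳ _))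
  lag-peel φ zero    (suc (suc e)) = sym (trans (+-identityʳ _) (zeroʳ _))
  lag-peel φ (suc a) (suc e)       = lag-peel φ a e

  convolve-δ₀ : ∀ φ x e → ∑ (suc x) (λ j → φ j * lag δ₀ x (j ℕ.+ e)) ≈ lag φ x e
  convolve-δ₀ φ zero    zero    = trans (∑-suc 0) (trans (+-cong (*-identityʳ _) (∑-0)) (+-identityʳ _))
  convolve-δ₀ φ zero    (suc e) = trans (∑-suc 0) (trans (+-cong (zeroʳ _) (∑-0)) (+-identityʳ _))
  convolve-δ₀ φ (suc x) e       =
    trans (∑-suc (suc x)) (trans (+-congˡ (convolve-δ₀ (λ j → φ (suc j)) x e)) (sym (lag-peel φ x e)))

  -- A solution of a recurrence is determined by its inhomogeneous term: by induction on a,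
  -- all delayed values of u and v at a agree.
  solves-unique : ∀ c K {u v h} → Solves c K u h → Solves c K v h → ∀ a → u a ≈ v a
  solves-unique c K {u} {v} (solves u-solves) (solves v-solves) a = lags-agree a 0
    where
    lags-agree : ∀ a d → lag u a d ≈ lag v a d
    lags-agree zero    zero    = trans (u-solves 0) (sym (v-solves 0))
    lags-agree zero    (suc d) = refl
    lags-agree (suc a) zero    =
      trans (u-solves (suc a)) (trans (+-congʳ (∑-cong K (λ i → *-congˡ (lags-agree a i)))) (sym (v-solves (suc a))))
    lags-agree (suc a) (suc d) = lags-agree a d

  solves-lag : ∀ {c K φ h} → Solves c K φ h →
               ∀ a d → lag φ a d ≈ ∑ K (λ i → c (suc i) * lag φ a (d ℕ.+ suc i)) + lag h a d
  solves-lag         φ-solves a       zero    = equation φ-solves a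
  solves-lag {K = K} φ-solves zero    (suc d) = sym (trans (+-identityʳ _) (∑-zero K (λ i → zeroʳ _)))
  solves-lag         φ-solves (suc a) (suc d) = solves-lag φ-solves a d

  if-cong : ∀ b {x y : Carrier} → x ≈ y → (if b then x else 0#) ≈ (if b then y else 0#)
  if-cong true  x≈y = x≈y
  if-cong false x≈y = refl

  if-neg : ∀ b {x : Carrier} → (if b then - x else 0#) ≈ - (if b then x else 0#)
  if-neg true  = refl
  if-neg false = sym -0#≈0#

  if-zero : ∀ b {x : Carrier} → x ≈ 0# → (if b then x else 0#) ≈ 0#
  if-zero true  x≈0 = x≈0
  if-zero false x≈0 = refl

  module LayerSums (z : ℕ → Carrier) (q : Carrier) where

    layerWeight : ℕ → Carrier
    layerWeight i = z i * pow q (i C 2)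

    compositionWeight : List ℕ → Carrier
    compositionWeight []       = 1#
    compositionWeight (ℓ ∷ ls) = layerWeight ℓ * compositionWeight ls

    summand-weight : ∀ ls → zProd z ls * pow q (inv (rlp ls)) ≈ compositionWeight ls
    summand-weight ls = trans (reflexive (cong (λ e → zProd z ls * pow q e) (inv-rlpFrom 0 ls))) (byLayers ls)
      where
      byLayers : ∀ ls → zProd z ls * pow q (layerPairs ls) ≈ compositionWeight ls
      byLayers []       = *-identityˡ _
      byLayers (ℓ ∷ ls) = trans (*-congˡ (pow-+ q (ℓ C 2) (layerPairs ls)))
                                (trans (interchange _ _ _ _) (*-congˡ (byLayers ls)))

    compositionSum : ℕ → ℕ → ℕ → Carrier
    compositionSum K fuel n = sumL (map compositionWeight (compsFuel fuel K n))

    F≈compositionSum : ∀ K n → F z q K n ≈ compositionSum K n n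
    F≈compositionSum K n = sumL-map-cong summand-weight (compositions K n)

    -- Sorting compositions by their first layer suc i.
    compositionSum-step : ∀ K fuel n → compositionSum K (suc fuel) (suc n) ≈
      ∑ (suc n) (λ i → if i <ᵇ K then layerWeight (suc i) * compositionSum K fuel (n ∸ i) else 0#)
    compositionSum-step K fuel n = begin
        sumL (map compositionWeight (concatMap withFirst firstLayers))
      ≈⟨ sumL-concatMap compositionWeight withFirst firstLayers ⟩
        sumL (map (λ ℓ → sumL (map compositionWeight (withFirst ℓ))) firstLayers)
      ≈⟨ sumL-filter _ (λ ℓ → ℓ ≤ᵇ K) (applyUpTo suc (suc n)) ⟩
        sumL (map (λ ℓ → if ℓ ≤ᵇ K then sumL (map compositionWeight (withFirst ℓ)) else 0#) (applyUpTo suc (suc n)))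
      ≈⟨ sumL-applyUpTo _ suc (suc n) ⟩
        ∑ (suc n) (λ i → if i <ᵇ K then sumL (map compositionWeight (withFirst (suc i))) else 0#)
      ≈⟨ ∑-cong (suc n) (λ i → if-cong (i <ᵇ K) (first-layer (suc i) (compsFuel fuel K (n ∸ i)))) ⟩
        ∑ (suc n) (λ i → if i <ᵇ K then layerWeight (suc i) * compositionSum K fuel (n ∸ i) else 0#)
      ∎
      where
      firstLayers : List ℕ
      firstLayers = filterᵇ (λ ℓ → ℓ ≤ᵇ K) (applyUpTo suc (suc n))
      withFirst : ℕ → List (List ℕ)
      withFirst ℓ = map (ℓ ∷_) (compsFuel fuel K (suc n ∸ ℓ))
      first-layer : ∀ ℓ L →
        sumL (map compositionWeight (map (ℓ ∷_) L)) ≈ layerWeight ℓ * sumL (map compositionWeight L)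
      first-layer ℓ L = trans (reflexive (cong sumL (≡.sym (map-∘ L)))) (sumL-*ˡ (layerWeight ℓ) compositionWeight L)

    compositionSum-fuel : ∀ K f g n → n ≤ f → n ≤ g → compositionSum K f n ≈ compositionSum K g n
    compositionSum-fuel K f       g       zero    _         _         = refl
    compositionSum-fuel K (suc f) (suc g) (suc n) (s≤s n≤f) (s≤s n≤g) = begin
        compositionSum K (suc f) (suc n)
      ≈⟨ compositionSum-step K f n ⟩
        ∑ (suc n) (λ i → if i <ᵇ K then layerWeight (suc i) * compositionSum K f (n ∸ i) else 0#)
      ≈⟨ ∑-cong (suc n) (λ i → if-cong (i <ᵇ K)
           (*-congˡ (compositionSum-fuel K f g (n ∸ i) (remaining n≤f i) (remaining n≤g i)))) ⟩
        ∑ (suc n) (λ i → if i <ᵇ K then layerWeight (suc i) * compositionSum K g (n ∸ i) else 0#)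
      ≈⟨ compositionSum-step K g n ⟨
        compositionSum K (suc g) (suc n)
      ∎
      where
      remaining : ∀ {m} → n ≤ m → ∀ i → n ∸ i ≤ m
      remaining n≤m i = ℕP.≤-trans (ℕP.m∸n≤m n i) n≤m

    -- The layer sums satisfy the recurrence: split off the first layer of each composition.
    F-equation : ∀ K a → F z q K a ≈ recStep layerWeight K (F z q K) a + δ₀ a
    F-equation K zero    =
      trans (+-identityʳ _) (trans (summand-weight [])
        (sym (trans (+-congʳ (∑-zero K (λ i → zeroʳ _))) (+-identityˡ 1#))))
    F-equation K (suc N) = begin
        F z q K (suc N)
      ≈⟨ F≈compositionSum K (suc N) ⟩
        compositionSum K (suc N) (suc N)
      ≈⟨ compositionSum-step K N N ⟩
        ∑ (suc N) (λ i → if i <ᵇ K then layerWeight (suc i) * compositionSum K N (N ∸ i) else 0#)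
      ≈⟨ ∑-cong< (suc N) (λ i i<1+N → if-cong (i <ᵇ K) (*-congˡ (enough-fuel i (ℕP.≤-pred i<1+N)))) ⟩
        ∑ (suc N) guarded
      ≈⟨ ∑-truncate (suc N) K past-N ⟨
        ∑ (suc N ℕ.+ K) guarded
      ≡⟨ cong (λ m → ∑ m guarded) (ℕP.+-comm (suc N) K) ⟩
        ∑ (K ℕ.+ suc N) guarded
      ≈⟨ ∑-truncate K (suc N) guard-off ⟩
        ∑ K guarded
      ≈⟨ ∑-cong< K guard-on ⟩
        recStep layerWeight K (F z q K) (suc N)
      ≈⟨ +-identityʳ _ ⟨
        recStep layerWeight K (F z q K) (suc N) + 0#
      ∎
      where
      guarded : ℕ → Carrier
      guarded i = if i <ᵇ K then layerWeight (suc i) * lag (F z q K) N i else 0#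
      guard-on : ∀ i → i < K → guarded i ≈ layerWeight (suc i) * lag (F z q K) N i
      guard-on i i<K rewrite <ᵇ-true i<K = refl
      guard-off : ∀ i → guarded (K ℕ.+ i) ≈ 0#
      guard-off i rewrite <ᵇ-false (ℕP.m≤m+n K i) = refl
      past-N : ∀ i → guarded (suc N ℕ.+ i) ≈ 0#
      past-N i = if-zero (suc N ℕ.+ i <ᵇ K)
        (trans (*-congˡ (reflexive (lag-beyond (F z q K) N (suc N ℕ.+ i) (s≤s (ℕP.m≤m+n N i))))) (zeroʳ _))
      enough-fuel : ∀ i → i ≤ N → compositionSum K N (N ∸ i) ≈ lag (F z q K) N i
      enough-fuel i i≤N = begin
          compositionSum K N (N ∸ i)
        ≈⟨ compositionSum-fuel K N (N ∸ i) (N ∸ i) (ℕP.m∸n≤m N i) ℕP.≤-refl ⟩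
          compositionSum K (N ∸ i) (N ∸ i)
        ≈⟨ F≈compositionSum K (N ∸ i) ⟨
          F z q K (N ∸ i)
        ≡⟨ lag-within (F z q K) N i i≤N ⟨
          lag (F z q K) N i
        ∎

    F-solves : ∀ K → Solves layerWeight K (F z q K) δ₀
    F-solves K = solves (F-equation K)

  module RaiseOrder (c : ℕ → Carrier) (k′ : ℕ) {A B : ℕ → Carrier}
                    (A-solves : Solves c k′ A δ₀) (B-solves : Solves c (suc k′) B δ₀) where

    k : ℕ
    k = suc k′

    correction : ℕ → ℕ → Carrier
    correction d x = ∑ (suc x) (λ j → A j * lag B x (d ℕ.+ (j ℕ.+ k)))

    candidate : ℕ → Carrier
    candidate x = A x + c k * correction 0 x

    -- Delaying the correction term only delays B, as the terms with j > x vanish anyway.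
    lag-correction : ∀ x d → lag (correction 0) x d ≈ correction d x
    lag-correction x       zero    = refl
    lag-correction zero    (suc d) = sym (trans (∑-suc 0) (trans (+-cong (zeroʳ _) ∑-0) (+-identityʳ _)))
    lag-correction (suc x) (suc d) = trans (lag-correction x d) (sym (begin
        ∑ (suc (suc x)) (λ j → A j * lag B x (d ℕ.+ (j ℕ.+ k)))
      ≈⟨ ∑-last (suc x) ⟩
        correction d x + A (suc x) * lag B x (d ℕ.+ (suc x ℕ.+ k))
      ≈⟨ +-congˡ (trans (*-congˡ (reflexive (lag-beyond B x _ x<d+x+k))) (zeroʳ _)) ⟩
        correction d x + 0#
      ≈⟨ +-identityʳ _ ⟩
        correction d x
      ∎))
      where
      x<d+x+k : x < d ℕ.+ (suc x ℕ.+ k)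
      x<d+x+k = ℕP.≤-trans (ℕP.m≤m+n (suc x) k) (ℕP.m≤n+m (suc x ℕ.+ k) d)

    stepped : ℕ → Carrier
    stepped x = ∑ (suc x) (λ j → A j * ∑ k (λ i → c (suc i) * lag B x ((j ℕ.+ k) ℕ.+ suc i)))

    correction-unfold : ∀ x → correction 0 x ≈ stepped x + lag A x k
    correction-unfold x = begin
        ∑ (suc x) (λ j → A j * lag B x (j ℕ.+ k))
      ≈⟨ ∑-cong (suc x) (λ j → trans (*-congˡ (solves-lag B-solves x (j ℕ.+ k))) (distribˡ _ _ _)) ⟩
        ∑ (suc x) (λ j → A j * ∑ k (λ i → c (suc i) * lag B x ((j ℕ.+ k) ℕ.+ suc i)) + A j * lag δ₀ x (j ℕ.+ k))
      ≈⟨ ∑-+ (suc x) ⟩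
        stepped x + ∑ (suc x) (λ j → A j * lag δ₀ x (j ℕ.+ k))
      ≈⟨ +-congˡ (convolve-δ₀ A x k) ⟩
        stepped x + lag A x k
      ∎

    stepped-correction : ∀ x → ∑ k (λ i → c (suc i) * correction (suc i) x) ≈ stepped x
    stepped-correction x = begin
        ∑ k (λ i → c (suc i) * ∑ (suc x) (λ j → A j * lag B x (suc i ℕ.+ (j ℕ.+ k))))
      ≈⟨ ∑-cong k (λ i → trans (∑-*ˡ (suc x) (c (suc i))) (∑-cong (suc x) (λ j →
           trans (x∙yz≈y∙xz _ _ _) (*-congˡ (*-congˡ (reflexive (cong (lag B x) (ℕP.+-comm (suc i) (j ℕ.+ k))))))))) ⟩
        ∑ k (λ i → ∑ (suc x) (λ j → A j * (c (suc i) * lag B x ((j ℕ.+ k) ℕ.+ suc i))))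
      ≈⟨ ∑-swap k (suc x) ⟩
        ∑ (suc x) (λ j → ∑ k (λ i → A j * (c (suc i) * lag B x ((j ℕ.+ k) ℕ.+ suc i))))
      ≈⟨ ∑-cong (suc x) (λ j → sym (∑-*ˡ k (A j))) ⟩
        stepped x
      ∎

    candidate-solves : Solves c k candidate δ₀
    candidate-solves = solves λ x → begin
        A x + c k * correction 0 x
      ≈⟨ +-cong (equation A-solves x) (*-congˡ (correction-unfold x)) ⟩
        (recStep c k′ A x + δ₀ x) + c k * (stepped x + lag A x k)
      ≈⟨ regroup-raise _ _ _ _ _ ⟩
        ((recStep c k′ A x + c k * lag A x k) + c k * stepped x) + δ₀ x
      ≈⟨ +-congʳ (+-cong (∑-last k′) (*-congˡ (stepped-correction x))) ⟨
        (recStep c k A x + c k * ∑ k (λ i → c (suc i) * correction (suc i) x)) + δ₀ x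
      ≈⟨ +-congʳ (+-congˡ (∑-*ˡ k (c k))) ⟩
        (recStep c k A x + ∑ k (λ i → c k * (c (suc i) * correction (suc i) x))) + δ₀ x
      ≈⟨ +-congʳ (∑-+ k) ⟨
        ∑ k (λ i → c (suc i) * lag A x (suc i) + c k * (c (suc i) * correction (suc i) x)) + δ₀ x
      ≈⟨ +-congʳ (∑-cong k (λ i → sym (trans (*-congˡ (lag-candidate x (suc i))) (distrib-scaled _ _ _ _)))) ⟩
        recStep c k candidate x + δ₀ x
      ∎
      where
      lag-candidate : ∀ x d → lag candidate x d ≈ lag A x d + c k * correction d x
      lag-candidate x d = trans (lag-+ A _ x d) (+-congˡ (trans (lag-*ˡ (c k) _ x d) (*-congˡ (lag-correction x d))))

    raise-order : ∀ x → B x ≈ A x + c k * correction 0 x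
    raise-order = solves-unique c k B-solves candidate-solves

  -- Splitting F(m + n) at position m: either a layer ends at m, giving F(m) F(n), or a layer of
  -- length i = i′ + 2 straddles m, covering j + 1 positions on the left (0 ≤ j ≤ i′).
  module SplitAt (c : ℕ → Carrier) (k′ : ℕ) {f : ℕ → Carrier} (f-solves : Solves c (suc k′) f δ₀) (n′ : ℕ) where

    k n : ℕ
    k = suc k′
    n = suc n′

    right : ℕ → ℕ → Carrier
    right i′ j = lag f (suc j ℕ.+ n) (suc (suc i′))

    straddle : ℕ → ℕ → Carrier
    straddle d m = ∑ k′ (λ i′ → ∑ (suc i′) (λ j → (c (suc (suc i′)) * lag f m (d ℕ.+ suc j)) * right i′ j))

    shifted candidate : ℕ → Carrier
    shifted m   = f (m ℕ.+ n)
    candidate m = f m * f n + straddle 0 m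

    -- overhang m d = f(m + n − d) when d > m, and 0 otherwise: the terms not seen by 'shifted'
    overhang : ℕ → ℕ → Carrier
    overhang m       zero    = 0#
    overhang zero    (suc d) = lag f n (suc d)
    overhang (suc m) (suc d) = overhang m d

    lag-shifted : ∀ m d → lag f (m ℕ.+ n) d ≈ lag shifted m d + overhang m d
    lag-shifted m       zero    = sym (+-identityʳ _)
    lag-shifted zero    (suc d) = sym (+-identityˡ _)
    lag-shifted (suc m) (suc d) = lag-shifted m d

    boundary : ℕ → Carrier
    boundary m = ∑ k (λ i → c (suc i) * overhang m (suc i))

    shifted-solves : Solves c k shifted boundary
    shifted-solves = solves λ m → begin
        f (m ℕ.+ n)
      ≈⟨ equation f-solves (m ℕ.+ n) ⟩
        recStep c k f (m ℕ.+ n) + δ₀ (m ℕ.+ n)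
      ≈⟨ +-cong (∑-cong k (λ i → trans (*-congˡ (lag-shifted m (suc i))) (distribˡ _ _ _)))
                (reflexive (cong δ₀ (ℕP.+-suc m n′))) ⟩
        ∑ k (λ i → c (suc i) * lag shifted m (suc i) + c (suc i) * overhang m (suc i)) + 0#
      ≈⟨ trans (+-identityʳ _) (∑-+ k) ⟩
        recStep c k shifted m + boundary m
      ∎

    lag-candidate : ∀ m d → lag candidate m d ≈ lag f m d * f n + straddle d m
    lag-candidate m d = trans (lag-+ _ _ m d) (+-cong (lag-*ʳ (f n) f m d)
      (trans (lag-∑ k′ _ m d) (∑-cong k′ (λ i′ → trans (lag-∑ (suc i′) _ m d) (∑-cong (suc i′) (λ j →
        trans (lag-*ʳ (right i′ j) _ m d) (*-congʳ (trans (lag-*ˡ (c (suc (suc i′))) _ m d)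
                                                          (*-congˡ (reflexive (lag-lag f (suc j) m d)))))))))))

    straddle-stepped straddle-δ : ℕ → Carrier
    straddle-stepped m = ∑ k′ (λ i′ → ∑ (suc i′) (λ j →
      (c (suc (suc i′)) * ∑ k (λ i → c (suc i) * lag f m (suc j ℕ.+ suc i))) * right i′ j))
    straddle-δ m = ∑ k′ (λ i′ → ∑ (suc i′) (λ j → (c (suc (suc i′)) * lag δ₀ m (suc j)) * right i′ j))

    straddle-unfold : ∀ m → straddle 0 m ≈ straddle-stepped m + straddle-δ m
    straddle-unfold m = trans (∑-cong k′ (λ i′ → trans (∑-cong (suc i′) (λ j →
        trans (*-congʳ (*-congˡ (solves-lag f-solves m (suc j)))) (distrib-weighted _ _ _ _)))
      (∑-+ (suc i′)))) (∑-+ k′)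

    straddle-step : ∀ m → ∑ k (λ i → c (suc i) * straddle (suc i) m) ≈ straddle-stepped m
    straddle-step m = begin
        ∑ k (λ i → c (suc i) * straddle (suc i) m)
      ≈⟨ ∑-cong k (λ i → trans (∑-*ˡ k′ (c (suc i))) (∑-cong k′ (λ i′ → ∑-*ˡ (suc i′) (c (suc i))))) ⟩
        ∑ k (λ i → ∑ k′ (λ i′ → ∑ (suc i′) (λ j → c (suc i) * weighted i′ (suc i ℕ.+ suc j) j)))
      ≈⟨ trans (∑-swap k k′) (∑-cong k′ (λ i′ → ∑-swap k (suc i′))) ⟩
        ∑ k′ (λ i′ → ∑ (suc i′) (λ j → ∑ k (λ i → c (suc i) * weighted i′ (suc i ℕ.+ suc j) j)))
      ≈⟨ ∑-cong k′ (λ i′ → ∑-cong (suc i′) (collect i′)) ⟩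
        straddle-stepped m
      ∎
      where
      weighted : ℕ → ℕ → ℕ → Carrier
      weighted i′ e j = (c (suc (suc i′)) * lag f m e) * right i′ j
      collect : ∀ i′ j → ∑ k (λ i → c (suc i) * weighted i′ (suc i ℕ.+ suc j) j)
                       ≈ (c (suc (suc i′)) * ∑ k (λ i → c (suc i) * lag f m (suc j ℕ.+ suc i))) * right i′ j
      collect i′ j = begin
          ∑ k (λ i → c (suc i) * weighted i′ (suc i ℕ.+ suc j) j)
        ≈⟨ ∑-cong k (λ i → trans (trans (sym (*-assoc _ _ _)) (*-congʳ (x∙yz≈y∙xz _ _ _)))
             (*-congʳ (*-congˡ (*-congˡ (reflexive (cong (lag f m) (ℕP.+-comm (suc i) (suc j)))))))) ⟩
          ∑ k (λ i → (c (suc (suc i′)) * (c (suc i) * lag f m (suc j ℕ.+ suc i))) * right i′ j)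
        ≈⟨ ∑-*ʳ k (right i′ j) ⟨
          ∑ k (λ i → c (suc (suc i′)) * (c (suc i) * lag f m (suc j ℕ.+ suc i))) * right i′ j
        ≈⟨ *-congʳ (∑-*ˡ k (c (suc (suc i′)))) ⟨
          (c (suc (suc i′)) * ∑ k (λ i → c (suc i) * lag f m (suc j ℕ.+ suc i))) * right i′ j
        ∎

    -- Only the term j = m of straddle-δ (m + 1) survives.
    pick : ∀ m i′ (a : Carrier) → ∑ (suc i′) (λ j → (a * lag δ₀ m j) * right i′ j) ≈ a * overhang m (suc i′)
    pick zero    i′       a = trans (∑-suc i′) (trans (+-congˡ (∑-zero i′ (λ j → trans (*-congʳ (zeroʳ a)) (zeroˡ _))))
                                                      (trans (+-identityʳ _) (*-congʳ (*-identityʳ a))))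
    pick (suc m) zero     a = trans (∑-suc 0) (trans (+-cong (trans (*-congʳ (zeroʳ a)) (zeroˡ _)) ∑-0)
                                                      (trans (+-identityʳ 0#) (sym (zeroʳ a))))
    pick (suc m) (suc i′) a = trans (∑-suc (suc i′)) (trans (+-cong (trans (*-congʳ (zeroʳ a)) (zeroˡ _)) (pick m i′ a))
                                                              (+-identityˡ _))

    boundary-split : ∀ m → boundary m ≈ δ₀ m * f n + straddle-δ m
    boundary-split zero    = begin
        recStep c k f n
      ≈⟨ +-identityʳ _ ⟨
        recStep c k f n + δ₀ n
      ≈⟨ equation f-solves n ⟨
        f n
      ≈⟨ trans (+-identityʳ _) (*-identityˡ _) ⟨
        1# * f n + 0#
      ≈⟨ +-congˡ (∑-zero k′ (λ i′ → ∑-zero (suc i′) (λ j → trans (*-congʳ (zeroʳ _)) (zeroˡ _)))) ⟨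
        1# * f n + straddle-δ 0
      ∎
    boundary-split (suc m) = begin
        ∑ k (λ i → c (suc i) * overhang (suc m) (suc i))
      ≈⟨ ∑-suc k′ ⟩
        c 1 * 0# + ∑ k′ (λ i′ → c (suc (suc i′)) * overhang m (suc i′))
      ≈⟨ +-cong (zeroʳ _) (∑-cong k′ (λ i′ → sym (pick m i′ (c (suc (suc i′)))))) ⟩
        0# + straddle-δ (suc m)
      ≈⟨ +-congʳ (zeroˡ (f n)) ⟨
        0# * f n + straddle-δ (suc m)
      ∎

    candidate-solves : Solves c k candidate boundary
    candidate-solves = solves λ m → begin
        f m * f n + straddle 0 m
      ≈⟨ +-cong (*-congʳ (equation f-solves m)) (straddle-unfold m) ⟩
        (recStep c k f m + δ₀ m) * f n + (straddle-stepped m + straddle-δ m)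
      ≈⟨ regroup-split _ _ _ _ _ ⟩
        (recStep c k f m * f n + straddle-stepped m) + (δ₀ m * f n + straddle-δ m)
      ≈⟨ +-cong (+-cong (∑-*ʳ k (f n)) (sym (straddle-step m))) (sym (boundary-split m)) ⟩
        (∑ k (λ i → (c (suc i) * lag f m (suc i)) * f n) + ∑ k (λ i → c (suc i) * straddle (suc i) m)) + boundary m
      ≈⟨ +-congʳ (∑-+ k) ⟨
        ∑ k (λ i → (c (suc i) * lag f m (suc i)) * f n + c (suc i) * straddle (suc i) m) + boundary m
      ≈⟨ +-congʳ (∑-cong k (λ i → sym (trans (*-congˡ (lag-candidate m (suc i)))
                                              (trans (distribˡ _ _ _) (+-congʳ (sym (*-assoc _ _ _))))))) ⟩
        recStep c k candidate m + boundary m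
      ∎

    split-at : ∀ m → f (m ℕ.+ n) ≈ f m * f n + straddle 0 m
    split-at = solves-unique c k shifted-solves candidate-solves

  -- Determinants of ℕ-indexed matrices, by Laplace expansion along the first row (the same
  -- recursion as Defs.det, with ℕ indices so that rows and columns can be manipulated freely).

  Matrix : Set c
  Matrix = ℕ → ℕ → Carrier

  sign : ℕ → Carrier
  sign zero    = 1#
  sign (suc j) = - sign j

  sign≈pow : ∀ a → sign a ≈ pow (- 1#) a
  sign≈pow zero    = refl
  sign≈pow (suc a) = trans (-‿cong (sign≈pow a)) (sym (-1*x≈-x _))

  sign-even : ∀ h → sign (h ℕ.* 2) ≈ 1#
  sign-even zero    = refl
  sign-even (suc h) = trans (-‿involutive _) (sign-even h)

  minor : Matrix → ℕ → Matrix
  minor A j s t = A (suc s) (skip j t)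

  detℕ : ℕ → Matrix → Carrier
  detℕ zero    A = 1#
  detℕ (suc n) A = ∑ (suc n) (λ j → sign j * (A 0 j * detℕ n (minor A j)))

  withRow₀ withRow₁ : (ℕ → Carrier) → Matrix → Matrix
  withRow₀ r A zero          = r
  withRow₀ r A (suc s)       = A (suc s)
  withRow₁ r A zero          = A zero
  withRow₁ r A (suc zero)    = r
  withRow₁ r A (suc (suc s)) = A (suc (suc s))

  -- the rows A i, A 0, A 1, A 2, …: row i moved in front of all rows
  pushFront : ℕ → Matrix → Matrix
  pushFront i A = withRow₀ (A i) (λ s → A (ℕ.pred s))

  det-cong : ∀ n {A B : Matrix} → (∀ s t → A s t ≈ B s t) → detℕ n A ≈ detℕ n B
  det-cong zero    h = refl
  det-cong (suc n) h = ∑-cong (suc n) (λ j → *-congˡ (*-cong (h 0 j) (det-cong n (λ s t → h (suc s) (skip j t)))))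

  det-cong≡ : ∀ n {A B : Matrix} → (∀ s t → A s t ≡ B s t) → detℕ n A ≈ detℕ n B
  det-cong≡ n h = det-cong n (λ s t → reflexive (h s t))

  det-row₀-additive : ∀ n (x y : ℕ → Carrier) A →
    detℕ (suc n) (withRow₀ (λ t → x t + y t) A) ≈ detℕ (suc n) (withRow₀ x A) + detℕ (suc n) (withRow₀ y A)
  det-row₀-additive n x y A =
    trans (∑-cong (suc n) (λ j → trans (*-congˡ (distribʳ _ _ _)) (distribˡ _ _ _))) (∑-+ (suc n))

  det-row₀-linear : ∀ n K (l : ℕ → Carrier) (r : ℕ → ℕ → Carrier) A →
    detℕ (suc n) (withRow₀ (λ t → ∑ K (λ i → l i * r i t)) A) ≈ ∑ K (λ i → l i * detℕ (suc n) (withRow₀ (r i) A))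
  det-row₀-linear n K l r A = begin
      ∑ (suc n) (λ j → sign j * (∑ K (λ i → l i * r i j) * D j))
    ≈⟨ ∑-cong (suc n) (λ j → trans (*-congˡ (∑-*ʳ K (D j)))
                                  (trans (∑-*ˡ K (sign j)) (∑-cong K (λ i → pull-out _ _ _ _)))) ⟩
      ∑ (suc n) (λ j → ∑ K (λ i → l i * (sign j * (r i j * D j))))
    ≈⟨ ∑-swap (suc n) K ⟩
      ∑ K (λ i → ∑ (suc n) (λ j → l i * (sign j * (r i j * D j))))
    ≈⟨ ∑-cong K (λ i → ∑-*ˡ (suc n) (l i)) ⟨
      ∑ K (λ i → l i * detℕ (suc n) (withRow₀ (r i) A))
    ∎
    where
    D : ℕ → Carrier
    D j = detℕ n (minor A j)
    pull-out : ∀ s a b d → s * ((a * b) * d) ≈ a * (s * (b * d))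
    pull-out s a b d = trans (*-congˡ (*-assoc a b d)) (x∙yz≈y∙xz s a (b * d))

  det-row₁-additive : ∀ m (u x y : ℕ → Carrier) A →
    detℕ (2 ℕ.+ m) (withRow₀ u (withRow₁ (λ t → x t + y t) A))
      ≈ detℕ (2 ℕ.+ m) (withRow₀ u (withRow₁ x A)) + detℕ (2 ℕ.+ m) (withRow₀ u (withRow₁ y A))
  det-row₁-additive m u x y A = trans (∑-cong (2 ℕ.+ m) (λ j →
      trans (*-congˡ (*-congˡ (trans (det-cong≡ (suc m) (minor-rows (λ t → x t + y t) j))
                               (trans (det-row₀-additive m (λ t → x (skip j t)) (λ t → y (skip j t)) (minor A j))
                                      (sym (+-cong (det-cong≡ (suc m) (minor-rows x j))
                                                   (det-cong≡ (suc m) (minor-rows y j))))))))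
            (trans (*-congˡ (distribˡ _ _ _)) (distribˡ _ _ _))))
    (∑-+ (2 ℕ.+ m))
    where
    minor-rows : ∀ v j s t → minor (withRow₀ u (withRow₁ v A)) j s t ≡ withRow₀ (λ t → v (skip j t)) (minor A j) s t
    minor-rows v j zero    t = ≡-refl
    minor-rows v j (suc s) t = ≡-refl

  -- A matrix whose first two rows agree has determinant 0.  Expanding along both rows, the
  -- product for the columns x < y of rows 0 and 1 occurs once with each sign.
  module EqualRows (m : ℕ) (A : Matrix) (rows≈ : ∀ t → A 1 t ≈ A 0 t) where

    u : ℕ → Carrier
    u = A 0

    E : ℕ → ℕ → Carrier
    E x y = detℕ m (λ r t → A (2 ℕ.+ r) (skip y (skip x t)))

    pair : ℕ → ℕ → Carrier
    pair x y = (sign x * sign y) * ((u x * u y) * E x y)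

    term : ℕ → ℕ → Carrier
    term a b = sign a * (u a * (sign b * (A 1 (skip a b) * detℕ m (minor (minor A a) b))))

    double-expansion : detℕ (2 ℕ.+ m) A ≈ ∑ (2 ℕ.+ m) (λ a → ∑ (suc m) (λ b → term a b))
    double-expansion = ∑-cong (2 ℕ.+ m) (λ a → trans (*-congˡ (∑-*ˡ (suc m) (u a))) (∑-*ˡ (suc m) (sign a)))

    term-pair : ∀ a b → term a b ≈ (if b <ᵇ a then pair b a else 0#) + (if a <ᵇ suc b then - pair a (suc b) else 0#)
    term-pair a b with b ℕ.<? a
    ... | yes b<a rewrite <ᵇ-true b<a | <ᵇ-false {a} {suc b} b<a | skip-below a b b<a =
      trans (*-congˡ (*-congˡ (*-congˡ (*-congʳ (rows≈ b))))) (trans (shuffle _ _ _ _ _) (sym (+-identityʳ _)))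
      where
      shuffle : ∀ (sa ua sb ub e : Carrier) → sa * (ua * (sb * (ub * e))) ≈ (sb * sa) * ((ub * ua) * e)
      shuffle = solve 5 (λ sa ua sb ub e → sa ⊕ (ua ⊕ (sb ⊕ (ub ⊕ e))) ⊜ (sb ⊕ sa) ⊕ ((ub ⊕ ua) ⊕ e)) refl
    ... | no b≮a with a≤b ← ℕP.≮⇒≥ b≮a
                 rewrite <ᵇ-false {b} {a} a≤b | <ᵇ-true {a} {suc b} (s≤s a≤b) | skip-above a b a≤b = begin
        sign a * (u a * (sign b * (A 1 (suc b) * detℕ m (minor (minor A a) b))))
      ≈⟨ *-congˡ (*-congˡ (*-congˡ (*-cong (rows≈ (suc b))
           (det-cong≡ m (λ r t → cong (A (2 ℕ.+ r)) (skip-skip a b t a≤b)))))) ⟩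
        sign a * (u a * (sign b * (u (suc b) * E a (suc b))))
      ≈⟨ shuffle _ _ _ _ _ ⟩
        (sign a * sign b) * ((u a * u (suc b)) * E a (suc b))
      ≈⟨ -‿involutive _ ⟨
        - - ((sign a * sign b) * ((u a * u (suc b)) * E a (suc b)))
      ≈⟨ -‿cong (trans (-‿distribˡ-* _ _) (*-congʳ (-‿distribʳ-* _ _))) ⟩
        - pair a (suc b)
      ≈⟨ +-identityˡ _ ⟨
        0# + - pair a (suc b)
      ∎
      where
      shuffle : ∀ (sa ua sb ub e : Carrier) → sa * (ua * (sb * (ub * e))) ≈ (sa * sb) * ((ua * ub) * e)
      shuffle = solve 5 (λ sa ua sb ub e → sa ⊕ (ua ⊕ (sb ⊕ (ub ⊕ e))) ⊜ (sa ⊕ sb) ⊕ ((ua ⊕ ub) ⊕ e)) refl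

    Q : Carrier
    Q = ∑ (suc m) (λ x → ∑ (suc m) (λ y → if x <ᵇ suc y then pair x (suc y) else 0#))

    positive negative : Carrier
    positive = ∑ (2 ℕ.+ m) (λ a → ∑ (suc m) (λ b → if b <ᵇ a then pair b a else 0#))
    negative = ∑ (2 ℕ.+ m) (λ a → ∑ (suc m) (λ b → if a <ᵇ suc b then - pair a (suc b) else 0#))

    positive≈Q : positive ≈ Q
    positive≈Q = trans (∑-swap (2 ℕ.+ m) (suc m)) (∑-cong (suc m) (λ b → trans (∑-suc (suc m)) (+-identityˡ _)))

    negative≈-Q : negative ≈ - Q
    negative≈-Q = begin
        negative
      ≈⟨ ∑-last (suc m) ⟩
        ∑ (suc m) (λ a → ∑ (suc m) (λ b → if a <ᵇ suc b then - pair a (suc b) else 0#))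
          + ∑ (suc m) (λ b → if m <ᵇ b then - pair (suc m) (suc b) else 0#)
      ≈⟨ +-congˡ (trans (∑-cong< (suc m) (λ b b<1+m → reflexive (cong (λ g → if g then - pair (suc m) (suc b) else 0#)
                                                                          (<ᵇ-false (ℕP.≤-pred b<1+m)))))
                        (∑-zero (suc m) (λ _ → refl))) ⟩
        ∑ (suc m) (λ a → ∑ (suc m) (λ b → if a <ᵇ suc b then - pair a (suc b) else 0#)) + 0#
      ≈⟨ +-identityʳ _ ⟩
        ∑ (suc m) (λ a → ∑ (suc m) (λ b → if a <ᵇ suc b then - pair a (suc b) else 0#))
      ≈⟨ ∑-cong (suc m) (λ a → trans (∑-cong (suc m) (λ b → if-neg (a <ᵇ suc b))) (∑-neg (suc m))) ⟩
        ∑ (suc m) (λ a → - ∑ (suc m) (λ b → if a <ᵇ suc b then pair a (suc b) else 0#))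
      ≈⟨ ∑-neg (suc m) ⟩
        - Q
      ∎

    det-equal-rows : detℕ (2 ℕ.+ m) A ≈ 0#
    det-equal-rows = begin
        detℕ (2 ℕ.+ m) A
      ≈⟨ double-expansion ⟩
        ∑ (2 ℕ.+ m) (λ a → ∑ (suc m) (λ b → term a b))
      ≈⟨ ∑-cong (2 ℕ.+ m) (λ a → trans (∑-cong (suc m) (term-pair a)) (∑-+ (suc m))) ⟩
        ∑ (2 ℕ.+ m) (λ a → ∑ (suc m) (λ b → if b <ᵇ a then pair b a else 0#)
                          + ∑ (suc m) (λ b → if a <ᵇ suc b then - pair a (suc b) else 0#))
      ≈⟨ ∑-+ (2 ℕ.+ m) ⟩
        positive + negative
      ≈⟨ +-cong positive≈Q negative≈-Q ⟩
        Q + - Q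
      ≈⟨ -‿inverseʳ Q ⟩
        0#
      ∎

  open EqualRows using (det-equal-rows)

  -- Exchanging the first two rows changes the sign (polarisation of det-equal-rows).
  det-swap-rows : ∀ m (x y : ℕ → Carrier) A →
    detℕ (2 ℕ.+ m) (withRow₀ y (withRow₁ x A)) ≈ - detℕ (2 ℕ.+ m) (withRow₀ x (withRow₁ y A))
  det-swap-rows m x y A = +-inverseʳ-unique _ _ (begin
      D x y + D y x
    ≈⟨ +-cong (+-identityˡ _) (+-identityʳ _) ⟨
      (0# + D x y) + (D y x + 0#)
    ≈⟨ +-cong (+-congʳ (vanishes x)) (+-congˡ (vanishes y)) ⟨
      (D x x + D x y) + (D y x + D y y)
    ≈⟨ trans (det-row₀-additive (suc m) x y (withRow₁ (λ t → x t + y t) A))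
             (+-cong (det-row₁-additive m x x y A) (det-row₁-additive m y x y A)) ⟨
      D (λ t → x t + y t) (λ t → x t + y t)
    ≈⟨ vanishes (λ t → x t + y t) ⟩
      0#
    ∎)
    where
    D : (ℕ → Carrier) → (ℕ → Carrier) → Carrier
    D v w = detℕ (2 ℕ.+ m) (withRow₀ v (withRow₁ w A))
    vanishes : ∀ v → D v v ≈ 0#
    vanishes v = det-equal-rows m (withRow₀ v (withRow₁ v A)) (λ t → refl)

  -- Moving row i + 1 to the front is a row swap followed by moving row i to the front of a minor.
  det-pushFront-suc : ∀ n i A →
    detℕ (2 ℕ.+ n) (pushFront (suc i) A)
      ≈ - ∑ (2 ℕ.+ n) (λ j → sign j * (A 0 j * detℕ (suc n) (pushFront i (minor A j))))
  det-pushFront-suc n i A =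
    trans (det-cong≡ (2 ℕ.+ n) as-swap)
          (trans (det-swap-rows n (A 0) (A (suc i)) rest)
                 (-‿cong (∑-cong (2 ℕ.+ n) (λ j → *-congˡ (*-congˡ (det-cong≡ (suc n) (minor-swapped j)))))))
    where
    rest : Matrix
    rest s = A (ℕ.pred s)
    as-swap : ∀ s t → pushFront (suc i) A s t ≡ withRow₀ (A (suc i)) (withRow₁ (A 0) rest) s t
    as-swap zero          t = ≡-refl
    as-swap (suc zero)    t = ≡-refl
    as-swap (suc (suc s)) t = ≡-refl
    minor-swapped : ∀ j s t → minor (withRow₀ (A 0) (withRow₁ (A (suc i)) rest)) j s t ≡ pushFront i (minor A j) s t
    minor-swapped j zero    t = ≡-refl
    minor-swapped j (suc s) t = ≡-refl

  det-pushFront-last : ∀ n A → detℕ (suc n) (pushFront n A) ≈ sign n * detℕ (suc n) A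
  det-pushFront-last zero    A = sym (*-identityˡ _)
  det-pushFront-last (suc n) A = begin
      detℕ (2 ℕ.+ n) (pushFront (suc n) A)
    ≈⟨ det-pushFront-suc n n A ⟩
      - ∑ (2 ℕ.+ n) (λ j → sign j * (A 0 j * detℕ (suc n) (pushFront n (minor A j))))
    ≈⟨ -‿cong (∑-cong (2 ℕ.+ n) (λ j → trans (*-congˡ (*-congˡ (det-pushFront-last n (minor A j))))
                                             (trans (*-congˡ (x∙yz≈y∙xz _ _ _)) (x∙yz≈y∙xz _ _ _)))) ⟩
      - ∑ (2 ℕ.+ n) (λ j → sign n * (sign j * (A 0 j * detℕ (suc n) (minor A j))))
    ≈⟨ -‿cong (∑-*ˡ (2 ℕ.+ n) (sign n)) ⟨
      - (sign n * detℕ (2 ℕ.+ n) A)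
    ≈⟨ -‿distribˡ-* _ _ ⟩
      sign (suc n) * detℕ (2 ℕ.+ n) A
    ∎

  -- Moving an earlier row to the front repeats a row.
  det-pushFront-repeated : ∀ n i A → i < n → detℕ (suc n) (pushFront i A) ≈ 0#
  det-pushFront-repeated (suc n) zero    A _         = det-equal-rows n (pushFront zero A) (λ t → refl)
  det-pushFront-repeated (suc n) (suc i) A (s≤s i<n) = begin
      detℕ (2 ℕ.+ n) (pushFront (suc i) A)
    ≈⟨ det-pushFront-suc n i A ⟩
      - ∑ (2 ℕ.+ n) (λ j → sign j * (A 0 j * detℕ (suc n) (pushFront i (minor A j))))
    ≈⟨ -‿cong (∑-zero (2 ℕ.+ n) (λ j → trans (*-congˡ (*-zeroʳ-by (det-pushFront-repeated n i (minor A j) i<n)))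
                                              (zeroʳ _))) ⟩
      - 0#
    ≈⟨ -0#≈0# ⟩
      0#
    ∎

  det-zero-column : ∀ n (A : Matrix) → (∀ s → A s 0 ≈ 0#) → detℕ (suc n) A ≈ 0#
  det-zero-column zero    A col≈0 =
    trans (∑-suc 0) (trans (+-cong (*-zeroʳ-by (*-zeroˡ-by (col≈0 0))) ∑-0) (+-identityˡ 0#))
  det-zero-column (suc n) A col≈0 = trans (∑-suc (suc n)) (trans (+-cong
      (*-zeroʳ-by (*-zeroˡ-by (col≈0 0)))
      (∑-zero (suc n) (λ j → *-zeroʳ-by (*-zeroʳ-by (det-zero-column n (minor A (suc j)) (λ s → col≈0 (suc s)))))))
    (+-identityˡ 0#))

  det-unitriangular : ∀ n (A : Matrix) → (∀ s t → t < s → A s t ≈ 0#) → (∀ s → A s s ≈ 1#) → detℕ n A ≈ 1#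
  det-unitriangular zero          A lower≈0 diag≈1 = refl
  det-unitriangular (suc zero)    A lower≈0 diag≈1 =
    trans (∑-suc 0) (trans (+-congˡ ∑-0) (trans (+-identityʳ _) (trans (*-identityˡ _) (trans (*-identityʳ _) (diag≈1 0)))))
  det-unitriangular (suc (suc n)) A lower≈0 diag≈1 = begin
      detℕ (2 ℕ.+ n) A
    ≈⟨ ∑-suc (suc n) ⟩
      1# * (A 0 0 * detℕ (suc n) (minor A 0))
        + ∑ (suc n) (λ j → sign (suc j) * (A 0 (suc j) * detℕ (suc n) (minor A (suc j))))
    ≈⟨ +-cong (*-congˡ (*-cong (diag≈1 0) (det-unitriangular (suc n) (minor A 0) lower′ (λ s → diag≈1 (suc s)))))
              (∑-zero (suc n) (λ j → *-zeroʳ-by (*-zeroʳ-by (det-zero-column n (minor A (suc j)) (λ s → lower≈0 (suc s) 0 (s≤s z≤n)))))) ⟩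
      1# * (1# * 1#) + 0#
    ≈⟨ trans (+-identityʳ _) (trans (*-identityˡ _) (*-identityˡ 1#)) ⟩
      1#
    ∎
    where
    lower′ : ∀ s t → t < s → minor A 0 s t ≈ 0#
    lower′ s t t<s = lower≈0 (suc s) (suc t) (s≤s t<s)

  toeplitz : (ℕ → Carrier) → ℕ → Matrix
  toeplitz f p s t = lag f (p ℕ.+ t) s

  solution-at-0 : ∀ {c K f} → Solves c K f δ₀ → f 0 ≈ 1#
  solution-at-0 {K = K} f-solves =
    trans (equation f-solves 0) (trans (+-congʳ (∑-zero K (λ i → zeroʳ _))) (+-identityˡ 1#))

  -- For a solution f of the order-k recurrence, the k × k Toeplitz determinants form a geometric
  -- sequence with ratio (−1)^{k−1} c_k: the first row of toeplitz f (p + 1) is a combination of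
  -- the rows of toeplitz f p, and its other rows are the first k − 1 rows of toeplitz f p.
  module ToeplitzDeterminant (c : ℕ → Carrier) (k′ : ℕ) {f : ℕ → Carrier} (f-solves : Solves c (suc k′) f δ₀) where

    k : ℕ
    k = suc k′

    det-toeplitz-step : ∀ p → detℕ k (toeplitz f (suc p)) ≈ (sign k′ * c k) * detℕ k (toeplitz f p)
    det-toeplitz-step p = begin
        detℕ k (toeplitz f (suc p))
      ≈⟨ det-cong k first-row-recurs ⟩
        detℕ k (withRow₀ (λ t → ∑ k (λ i → c (suc i) * toeplitz f p i t)) below)
      ≈⟨ det-row₀-linear k′ k (λ i → c (suc i)) (toeplitz f p) below ⟩
        ∑ k (λ i → c (suc i) * detℕ k (pushFront i (toeplitz f p)))
      ≈⟨ ∑-last k′ ⟩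
        ∑ k′ (λ i → c (suc i) * detℕ k (pushFront i (toeplitz f p))) + c k * detℕ k (pushFront k′ (toeplitz f p))
      ≈⟨ +-cong (trans (∑-cong< k′ (λ i i<k′ → *-zeroʳ-by (det-pushFront-repeated k′ i (toeplitz f p) i<k′)))
                       (∑-zero k′ (λ _ → refl)))
                (*-congˡ (det-pushFront-last k′ (toeplitz f p))) ⟩
        0# + c k * (sign k′ * detℕ k (toeplitz f p))
      ≈⟨ trans (+-identityˡ _) (trans (sym (*-assoc _ _ _)) (*-congʳ (*-comm _ _))) ⟩
        (sign k′ * c k) * detℕ k (toeplitz f p)
      ∎
      where
      below : Matrix
      below s = toeplitz f p (ℕ.pred s)
      first-row-recurs : ∀ s t →
        toeplitz f (suc p) s t ≈ withRow₀ (λ t → ∑ k (λ i → c (suc i) * toeplitz f p i t)) below s t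
      first-row-recurs zero    t = trans (equation f-solves (suc (p ℕ.+ t))) (+-identityʳ _)
      first-row-recurs (suc s) t = refl

    det-toeplitz : ∀ p → detℕ k (toeplitz f p) ≈ pow (sign k′ * c k) p
    det-toeplitz zero    = det-unitriangular k (toeplitz f 0) (λ s t t<s → reflexive (lag-beyond f t s t<s))
      (λ s → trans (reflexive (≡.trans (lag-within f s s ℕP.≤-refl) (cong f (ℕP.n∸n≡0 s)))) (solution-at-0 f-solves))
    det-toeplitz (suc p) = trans (det-toeplitz-step p) (*-congˡ (det-toeplitz p))

  -- Defs.det takes its cofactor signs from a function local to its definition.  We name that
  -- function by unification: 'unfolds' holds by refl exactly when 'cofactor' is the local sign,
  -- and then the recursion equations of the sign hold by refl as well.
  record LaplaceSign : Set c where
    field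
      cofactor      : ∀ {m} → Fin m → Carrier
      unfolds       : ∀ m → det (suc m) (λ _ _ → 0#) ≡
                        1# * (0# * det m (λ _ _ → 0#)) + sumFin m (λ j → - cofactor j * (0# * det m (λ _ _ → 0#)))
      cofactor-zero : ∀ {m} → cofactor {suc m} Fin.zero ≡ 1#
      cofactor-suc  : ∀ {m} (j : Fin m) → cofactor (Fin.suc j) ≡ - cofactor j

  laplaceSign : LaplaceSign
  laplaceSign = record
    { cofactor      = λ {m} j → _
    ; unfolds       = λ m → ≡-refl
    ; cofactor-zero = ≡-refl
    ; cofactor-suc  = λ j → ≡-refl
    }

  open LaplaceSign laplaceSign using (cofactor; cofactor-zero; cofactor-suc)

  cofactor≈sign : ∀ {m} (j : Fin m) → cofactor j ≈ sign (toℕ j)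
  cofactor≈sign {suc m} Fin.zero    = reflexive (cofactor-zero {m})
  cofactor≈sign {suc m} (Fin.suc j) = trans (reflexive (cofactor-suc j)) (-‿cong (cofactor≈sign j))

  sumFin≈∑ : ∀ n (g : Fin n → Carrier) (h : ℕ → Carrier) → (∀ j → g j ≈ h (toℕ j)) → sumFin n g ≈ ∑ n h
  sumFin≈∑ zero    g h g≈h = sym ∑-0
  sumFin≈∑ (suc n) g h g≈h =
    trans (+-cong (g≈h Fin.zero) (sumFin≈∑ n (λ j → g (Fin.suc j)) (λ i → h (suc i)) (λ j → g≈h (Fin.suc j))))
          (sym (∑-suc n))

  det≈detℕ : ∀ n (M : Fin n → Fin n → Carrier) (A : Matrix) → (∀ s t → M s t ≈ A (toℕ s) (toℕ t)) → det n M ≈ detℕ n A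
  det≈detℕ zero    M A M≈A = refl
  det≈detℕ (suc n) M A M≈A =
    sumFin≈∑ (suc n) (λ j → cofactor j * (M Fin.zero j * det n (λ s t → M (Fin.suc s) (punchIn j t))))
                     (λ j → sign j * (A 0 j * detℕ n (minor A j)))
                     (λ j → *-cong (cofactor≈sign j) (*-cong (M≈A Fin.zero j) (det≈detℕ n _ _ (λ s t →
                        trans (M≈A (Fin.suc s) (punchIn j t)) (reflexive (cong (A (suc (toℕ s))) (toℕ-punchIn j t)))))))

  module Statements (z : ℕ → Carrier) (q : Carrier) where

    open LayerSums z q

    FZ-⊖ : ∀ K a b → FZ z q K (a ⊖ b) ≡ lag (F z q K) a b
    FZ-⊖ K a       zero    = ≡-refl
    FZ-⊖ K zero    (suc b) = ≡-refl
    FZ-⊖ K (suc a) (suc b) rewrite ℤP.[1+m]⊖[1+n]≡m⊖n a b = FZ-⊖ K a b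

    sumFromTo≈∑ : ∀ a b (g : ℤ → Carrier) n → clip ((b -ℤ + a) +ℤ + 1) ≡ n →
                  sumFromTo (+ a) b g ≈ ∑ n (λ i → g (+ (a ℕ.+ i)))
    sumFromTo≈∑ a b g n count =
      reflexive (≡.trans (cong (λ L → sumN L (λ i → g (+ (a ℕ.+ i)))) count) (≡.sym (∑≡sumN n _)))

    split-identity : ∀ k′ m n′ →
      F z q (suc k′) (m ℕ.+ suc n′) ≈
        F z q (suc k′) m * F z q (suc k′) (suc n′)
        + sumFromTo (+ 2) (+ suc k′) (λ i → sumFromTo (+ 1) (i -ℤ + 1) (λ j →
            z ∣ i ∣ * pow q (∣ i ∣ C 2) * FZ z q (suc k′) (+ m -ℤ j) * FZ z q (suc k′) ((+ suc n′ -ℤ i) +ℤ j)))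
    split-identity k′ m n′ = trans (split-at m) (+-congˡ (sym (begin
        sumFromTo (+ 2) (+ suc k′) outer
      ≈⟨ sumFromTo≈∑ 2 (+ suc k′) outer k′ (clip-⊖ (suc k′) 2) ⟩
        ∑ k′ (λ i′ → sumFromTo (+ 1) (+ suc i′) (term i′))
      ≈⟨ ∑-cong k′ (λ i′ → sumFromTo≈∑ 1 (+ suc i′) (term i′) (suc i′) (clip-⊖ (suc i′) 1)) ⟩
        ∑ k′ (λ i′ → ∑ (suc i′) (λ j → term i′ (+ suc j)))
      ≈⟨ ∑-cong k′ (λ i′ → ∑-cong (suc i′) (λ j → reflexive (cong₂ (λ l r → (layerWeight (suc (suc i′)) * l) * r)
           (FZ-⊖ (suc k′) m (suc j))
           (≡.trans (cong (FZ z q (suc k′)) (ℤP.distribˡ-⊖-+-pos (suc j) (suc n′) (suc (suc i′))))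
                    (≡.trans (FZ-⊖ (suc k′) (suc n′ ℕ.+ suc j) (suc (suc i′)))
                             (cong (λ x → lag (F z q (suc k′)) x (suc (suc i′))) (ℕP.+-comm (suc n′) (suc j)))))))) ⟩
        straddle 0 m
      ∎)))
      where
      open SplitAt layerWeight k′ (F-solves (suc k′)) n′ using (split-at; straddle)
      term : ℕ → ℤ → Carrier
      term i′ j = layerWeight (suc (suc i′)) * FZ z q (suc k′) (+ m -ℤ j)
                    * FZ z q (suc k′) ((+ suc n′ -ℤ + suc (suc i′)) +ℤ j)
      outer : ℤ → Carrier
      outer i = sumFromTo (+ 1) (i -ℤ + 1) (λ j →
                  z ∣ i ∣ * pow q (∣ i ∣ C 2) * FZ z q (suc k′) (+ m -ℤ j) * FZ z q (suc k′) ((+ suc n′ -ℤ i) +ℤ j))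

    raise-identity : ∀ k′ n →
      F z q (suc k′) n ≈
        F z q (suc k′ ∸ 1) n
        + sumFromTo (+ 0) (+ n -ℤ + suc k′) (λ j →
            z (suc k′) * pow q (suc k′ C 2) * FZ z q (suc k′ ∸ 1) j * FZ z q (suc k′) ((+ n -ℤ + suc k′) -ℤ j))
    raise-identity k′ n = trans (raise-order n) (+-congˡ (begin
        layerWeight k * ∑ (suc n) (λ j → F z q k′ j * lag B n (j ℕ.+ k))
      ≈⟨ trans (∑-*ˡ (suc n) (layerWeight k)) (∑-cong (suc n) (λ j →
           trans (sym (*-assoc _ _ _)) (*-congˡ (reflexive (cong (lag B n) (ℕP.+-comm j k)))))) ⟩
        ∑ (suc n) term
      ≈⟨ reflexive (cong (λ L → ∑ L term) (≡.sym (ℕP.m+[n∸m]≡n (ℕP.m∸n≤m (suc n) k)))) ⟩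
        ∑ (suc n ∸ k ℕ.+ (suc n ∸ (suc n ∸ k))) term
      ≈⟨ ∑-truncate (suc n ∸ k) _ (λ i → trans (*-congˡ (reflexive (lag-beyond B n _ (beyond i)))) (zeroʳ _)) ⟩
        ∑ (suc n ∸ k) term
      ≈⟨ ∑-cong (suc n ∸ k) (λ j → *-congˡ (reflexive (≡.sym
           (≡.trans (cong (FZ z q k) (⊖-minus n k j)) (FZ-⊖ k n (k ℕ.+ j)))))) ⟩
        ∑ (suc n ∸ k) (λ j → summand (+ j))
      ≈⟨ sumFromTo≈∑ 0 (n ⊖ k) summand (suc n ∸ k)
           (≡.trans (cong (λ x → clip (x +ℤ + 1)) (ℤP.+-identityʳ (n ⊖ k))) (clip-⊖ n k)) ⟨
        sumFromTo (+ 0) (n ⊖ k) summand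
      ∎))
      where
      k : ℕ
      k = suc k′
      B : ℕ → Carrier
      B = F z q k
      open RaiseOrder layerWeight k′ (F-solves k′) (F-solves k) using (raise-order)
      term : ℕ → Carrier
      term j = (layerWeight k * F z q k′ j) * lag B n (k ℕ.+ j)
      summand : ℤ → Carrier
      summand j = z k * pow q (k C 2) * FZ z q k′ j * FZ z q k ((+ n -ℤ + k) -ℤ j)
      beyond : ∀ i → n < k ℕ.+ (suc n ∸ k ℕ.+ i)
      beyond i = ℕP.≤-trans (ℕP.m≤n+m∸n (suc n) k) (ℕP.+-monoʳ-≤ k (ℕP.m≤m+n (suc n ∸ k) i))

    -- The statement's matrix is the Toeplitz matrix of F_k with offset N = n + k − 1.
    det-identity : ∀ k′ n′ → det (suc k′) (λ s t → F z q (suc k′) ((suc n′ ℕ.+ suc k′ ∸ 1 ℕ.+ toℕ t) ∸ toℕ s))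
                               ≈ pow (sign k′ * layerWeight (suc k′)) (n′ ℕ.+ suc k′)
    det-identity k′ n′ = trans (det≈detℕ (suc k′) _ (toeplitz f N) entries) (det-toeplitz N)
      where
      open ToeplitzDeterminant layerWeight k′ (F-solves (suc k′)) using (det-toeplitz)
      N : ℕ
      N = n′ ℕ.+ suc k′
      f : ℕ → Carrier
      f = F z q (suc k′)
      entries : ∀ (s t : Fin (suc k′)) → f ((N ℕ.+ toℕ t) ∸ toℕ s) ≈ toeplitz f N (toℕ s) (toℕ t)
      entries s t = reflexive (≡.sym (lag-within f (N ℕ.+ toℕ t) (toℕ s) row≤))
        where
        row≤ : toℕ s ≤ N ℕ.+ toℕ t
        row≤ = ℕP.≤-trans (ℕP.≤-pred (toℕ<n s))
                 (ℕP.≤-trans (ℕP.≤-trans (ℕP.n≤1+n k′) (ℕP.m≤n+m (suc k′) n′)) (ℕP.m≤m+n N (toℕ t)))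

    weight-power : ∀ k N → pow (layerWeight k) N ≈ pow (z k) N * pow q (N ℕ.* (k C 2))
    weight-power k N = trans (pow-* (z k) _ N) (*-congˡ (pow-pow q (k C 2) N))

    halve : ∀ k {r} → k % 2 ≡ r → k ≡ r ℕ.+ (k / 2) ℕ.* 2
    halve k k%2≡r = ≡.trans (m≡m%n+[m/n]*n k 2) (cong (ℕ._+ (k / 2) ℕ.* 2) k%2≡r)

    det-odd : ∀ k′ n′ → suc k′ % 2 ≡ 1 →
      det (suc k′) (λ s t → F z q (suc k′) ((suc n′ ℕ.+ suc k′ ∸ 1 ℕ.+ toℕ t) ∸ toℕ s))
        ≈ pow (z (suc k′)) (n′ ℕ.+ suc k′) * pow q ((n′ ℕ.+ suc k′) ℕ.* (suc k′ C 2))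
    det-odd k′ n′ k-odd = begin
        det (suc k′) (λ s t → F z q (suc k′) ((suc n′ ℕ.+ suc k′ ∸ 1 ℕ.+ toℕ t) ∸ toℕ s))
      ≈⟨ det-identity k′ n′ ⟩
        pow (sign k′ * layerWeight (suc k′)) (n′ ℕ.+ suc k′)
      ≈⟨ pow-cong (n′ ℕ.+ suc k′) (trans (*-congʳ sign-k′) (*-identityˡ _)) ⟩
        pow (layerWeight (suc k′)) (n′ ℕ.+ suc k′)
      ≈⟨ weight-power (suc k′) (n′ ℕ.+ suc k′) ⟩
        pow (z (suc k′)) (n′ ℕ.+ suc k′) * pow q ((n′ ℕ.+ suc k′) ℕ.* (suc k′ C 2))
      ∎
      where
      sign-k′ : sign k′ ≈ 1#
      sign-k′ = trans (reflexive (cong sign (ℕP.suc-injective (halve (suc k′) k-odd)))) (sign-even (suc k′ / 2))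

    det-even : ∀ k′ n′ → suc k′ % 2 ≡ 0 →
      det (suc k′) (λ s t → F z q (suc k′) ((suc n′ ℕ.+ suc k′ ∸ 1 ℕ.+ toℕ t) ∸ toℕ s))
        ≈ pow (- 1#) n′ * (pow (z (suc k′)) (n′ ℕ.+ suc k′) * pow q ((n′ ℕ.+ suc k′) ℕ.* (suc k′ C 2)))
    det-even k′ n′ k-even = begin
        det (suc k′) (λ s t → F z q (suc k′) ((suc n′ ℕ.+ suc k′ ∸ 1 ℕ.+ toℕ t) ∸ toℕ s))
      ≈⟨ det-identity k′ n′ ⟩
        pow (sign k′ * layerWeight (suc k′)) (n′ ℕ.+ suc k′)
      ≈⟨ pow-* (sign k′) _ (n′ ℕ.+ suc k′) ⟩
        pow (sign k′) (n′ ℕ.+ suc k′) * pow (layerWeight (suc k′)) (n′ ℕ.+ suc k′)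
      ≈⟨ *-cong sign-power (weight-power (suc k′) (n′ ℕ.+ suc k′)) ⟩
        pow (- 1#) n′ * (pow (z (suc k′)) (n′ ℕ.+ suc k′) * pow q ((n′ ℕ.+ suc k′) ℕ.* (suc k′ C 2)))
      ∎
      where
      k≡2h : suc k′ ≡ (suc k′ / 2) ℕ.* 2
      k≡2h = halve (suc k′) k-even
      sign-k′ : ∀ h → suc k′ ≡ h ℕ.* 2 → sign k′ ≈ - 1#
      sign-k′ (suc h) k≡ = trans (reflexive (cong sign (ℕP.suc-injective k≡))) (-‿cong (sign-even h))
      sign-power : pow (sign k′) (n′ ℕ.+ suc k′) ≈ pow (- 1#) n′
      sign-power = begin
          pow (sign k′) (n′ ℕ.+ suc k′)
        ≈⟨ pow-cong (n′ ℕ.+ suc k′) (sign-k′ (suc k′ / 2) k≡2h) ⟩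
          pow (- 1#) (n′ ℕ.+ suc k′)
        ≈⟨ pow-+ (- 1#) n′ (suc k′) ⟩
          pow (- 1#) n′ * pow (- 1#) (suc k′)
        ≈⟨ *-congˡ (trans (sym (sign≈pow (suc k′))) (trans (reflexive (cong sign k≡2h)) (sign-even (suc k′ / 2)))) ⟩
          pow (- 1#) n′ * 1#
        ≈⟨ *-identityʳ _ ⟩
          pow (- 1#) n′
        ∎

mainTheorem9 : ∀ {c ℓ : Level} (R : CommutativeRing c ℓ) → let open CommutativeRing R in let open Poly R in
  (z : ℕ → Carrier) (q : Carrier) (k : ℕ) → 1 ≤ k →
    (∀ (m n : ℕ) → 1 ≤ m → 1 ≤ n →
      F z q k (m Data.Nat.+ n) ≈
        F z q k m * F z q k n
        + sumFromTo (+ 2) (+ k) (λ i → sumFromTo (+ 1) (i -ℤ + 1) (λ j →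
            z ∣ i ∣ * pow q (∣ i ∣ C 2) * FZ z q k (+ m -ℤ j) * FZ z q k ((+ n -ℤ i) +ℤ j))))
  × (∀ (n : ℕ) → 1 ≤ n →
      F z q k n ≈
        F z q (k ∸ 1) n
        + sumFromTo (+ 0) (+ n -ℤ + k) (λ j →
            z k * pow q (k C 2) * FZ z q (k ∸ 1) j * FZ z q k ((+ n -ℤ + k) -ℤ j)))
  × (∀ (n : ℕ) → 1 ≤ n → k % 2 ≡ 1 →
      det k (λ s t → F z q k ((n Data.Nat.+ k ∸ 1 Data.Nat.+ toℕ t) ∸ toℕ s)) ≈
        pow (z k) (n Data.Nat.+ k ∸ 1) * pow q ((n Data.Nat.+ k ∸ 1) Data.Nat.* (k C 2)))
  × (∀ (n : ℕ) → 1 ≤ n → k % 2 ≡ 0 →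
      det k (λ s t → F z q k ((n Data.Nat.+ k ∸ 1 Data.Nat.+ toℕ t) ∸ toℕ s)) ≈
        pow (- 1#) (n ∸ 1) * (pow (z k) (n Data.Nat.+ k ∸ 1) * pow q ((n Data.Nat.+ k ∸ 1) Data.Nat.* (k C 2))))
mainTheorem9 R z q (suc k′) (s≤s z≤n) =
    (λ { m (suc n′) _ (s≤s z≤n) → split-identity k′ m n′ })
  , (λ n _ → raise-identity k′ n)
  , (λ { (suc n′) (s≤s z≤n) k-odd → det-odd k′ n′ k-odd })
  , (λ { (suc n′) (s≤s z≤n) k-even → det-even k′ n′ k-even })
  where open Statements R z q
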